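{- For every integer $n\geq 2$, the graph $G(L(\Pi_n))$ has a Hamiltonian cycle, where $\Pi_n$ is the permutahedron.
   Context: The permutahedron $\Pi_n$ is the convex hull of $\{(\pi(1),\ldots,\pi(n)) : \pi\in S_n\}$; it is $(n-1)$-dimensional. Its nonempty faces correspond to ordered set partitions $A_1|\cdots|A_k$ of $[n]$ (a $k$-block partition is an $(n-k)$-dimensional face), and two nonempty faces are in a cover relation iff the partitions differ by merging two consecutive blocks into one. For a polytope $P$, $L(P)$ is the inclusion order of all faces of $P$ (including $\emptyset$, of dimension $-1$, and $P$), and $G(L(P))$ is its cover graph, with edges between $F\subset F'$ with $\dim F'=\dim F+1$. -}

module Defs where

open import Data.Nat using (ℕ; suc; _≤_)
open import Data.Fin using (Fin; pinch)
open import Data.Vec using (Vec; map)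
open import Data.Vec.Membership.Propositional using () renaming (_∈_ to _∈ᵥ_)
open import Data.Maybe using (Maybe; just; nothing)
open import Data.Product using (Σ; ∃; _,_; _×_)
open import Data.Sum using (_⊎_)
open import Data.Unit using (⊤)
open import Data.List using (List; length; _∷_; [])
open import Data.List.Membership.Propositional using (_∈_)
open import Data.List.Relation.Unary.All using (All)
open import Data.List.Relation.Unary.Unique.Propositional using (Unique)
open import Data.List.Relation.Unary.Linked using (Linked)
open import Relation.Binary.PropositionalEquality using (_≡_)

-- An ordered set partition A_1 | ... | A_k of [n] = Fin n is encoded by
-- its block-assignment vector  v : Vec (Fin k) n  (element x lies in block
-- lookup v x); it is a genuine ordered set partition iff every block is
-- nonempty, i.e. v is surjective onto Fin k.
OSP : ℕ → Set
OSP n = Σ ℕ λ k → Vec (Fin k) n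

-- Faces of the permutahedron Π_n (raw data): nothing = the empty face,
-- just (k , v) = the face of dimension n - k given by the ordered set
-- partition v.
RawFace : ℕ → Set
RawFace n = Maybe (OSP n)

IsOSP : ∀ {n} → OSP n → Set
IsOSP {n} (k , v) = ∀ (j : Fin k) → j ∈ᵥ v

IsFace : ∀ {n} → RawFace n → Set
IsFace nothing  = ⊤
IsFace (just p) = IsOSP p

-- Cover relation F ⋖ G (F ⊂ G, dim G = dim F + 1) in L(Π_n).
-- * ∅ ⋖ vertex: vertices are the n-block ordered set partitions.
-- * (k+1 blocks) ⋖ (k blocks) obtained by merging blocks i and i+1
--   (pinch i sends block j ↦ j for j ≤ i and j ↦ j - 1 for j > i).
data _⋖_ {n : ℕ} : RawFace n → RawFace n → Set where
  empty⋖vertex : (v : Vec (Fin n) n) → IsOSP (n , v) →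
                 nothing ⋖ just (n , v)
  merge⋖ : ∀ {k} (v : Vec (Fin (suc k)) n) (i : Fin k) →
           IsOSP (suc k , v) →
           just (suc k , v) ⋖ just (k , map (pinch i) v)

Adj : ∀ {n} → RawFace n → RawFace n → Set
Adj F G = F ⋖ G ⊎ G ⋖ F

last : ∀ {A : Set} → A → List A → A
last x []       = x
last x (y ∷ ys) = last y ys

IsHamiltonianCycle : ∀ {n} → RawFace n → List (RawFace n) → Set
IsHamiltonianCycle {n} F₀ Fs =
  All IsFace (F₀ ∷ Fs) ×
  Unique (F₀ ∷ Fs) ×
  (∀ (F : RawFace n) → IsFace F → F ∈ (F₀ ∷ Fs)) ×
  Linked Adj (F₀ ∷ Fs) ×
  Adj (last F₀ Fs) F₀ ×
  2 ≤ length Fs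

HasHamiltonianCycle : ℕ → Set
HasHamiltonianCycle n = Σ (RawFace n) λ F₀ → Σ (List (RawFace n)) λ Fs →
  IsHamiltonianCycle F₀ Fs

-- Forgetting the element 0 maps each face of Π_{n+1} to a face of Π_n.  The
-- faces over a face ρ with k blocks put 0 either into a new singleton block in
-- one of the k + 1 gaps or into one of the k blocks; listed as
--   gap 0, block 0, gap 1, block 1, …, gap k
-- each one covers or is covered by the next (merge the singleton {0} with a
-- neighbouring block).  Given a Hamiltonian path ρ₁, …, ρₘ through the nonempty
-- faces of Π_n, traverse these fibres alternately forwards and backwards: the
-- junction between the fibres of ρᵢ and ρᵢ₊₁ joins the two faces having {0} as
-- a singleton block at the same end, and these are adjacent because ρᵢ and
-- ρᵢ₊₁ are.  The result is a Hamiltonian path through the nonempty faces of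
-- Π_{n+1} from a vertex to a vertex, and the empty face, adjacent to every
-- vertex, closes it up.
module Submission where

open import Defs
open import Data.Bool using (Bool; true; false; not)
open import Data.Empty using (⊥-elim)
open import Data.Fin using (Fin; zero; suc; pinch; punchIn; punchOut; inject₁; fromℕ; opposite; _≟_)
open import Data.Fin.Properties
  using (punchInᵢ≢i; punchIn-punchOut; punchOut-punchIn; punchOut-cong; suc-injective; opposite-involutive)
open import Data.List using (List; []; _∷_; _++_; length)
import Data.List as List
open import Data.List.Properties using (++-identityʳ; length-map)
open import Data.List.Membership.Propositional using (_∈_)
open import Data.List.Membership.Propositional.Properties using (∈-++⁺ˡ; ∈-++⁺ʳ; ∈-++⁻; ∈-map⁺)
open import Data.List.Relation.Unary.Any using (here; there)
open import Data.List.Relation.Unary.All as All using (All; []; _∷_)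
import Data.List.Relation.Unary.All.Properties as All
open import Data.List.Relation.Unary.AllPairs using ([]; _∷_)
open import Data.List.Relation.Unary.Unique.Propositional using (Unique)
import Data.List.Relation.Unary.Unique.Propositional.Properties as Unique
open import Data.List.Relation.Unary.Linked using (Linked; [-]; _∷_)
import Data.List.Relation.Unary.Linked.Properties as Linked
open import Data.Maybe using (just; nothing)
open import Data.Maybe.Properties using (just-injective)
open import Data.Nat using (ℕ; zero; suc; _≤_; z≤n; s≤s)
import Data.Nat.Properties as ℕ
open import Data.Product using (∃; _,_; _×_; proj₁)
open import Data.Product.Properties using (,-injectiveˡ; ,-injectiveʳ-UIP)
open import Data.Sum using (_⊎_; inj₁; inj₂) renaming (map to map-⊎)
open import Data.Unit using (tt)
open import Data.Vec using (Vec; []; _∷_; map)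
open import Data.Vec.Properties using (map-∘; map-cong; map-id; ∷-injectiveˡ)
import Data.Vec.Relation.Unary.Any as VecAny
open import Data.Vec.Membership.Propositional using () renaming (_∈_ to _∈ᵥ_; _∉_ to _∉ᵥ_)
import Data.Vec.Membership.Propositional.Properties as VecMembership
open import Function using (_∘_)
open import Relation.Nullary using (¬_; yes; no)
open import Relation.Binary.PropositionalEquality
  using (_≡_; _≢_; refl; sym; trans; cong; cong₂; subst; subst₂; module ≡-Reasoning)
open ≡-Reasoning

private
  variable
    A : Set
    k n : ℕ

pinch-inject₁-self : (i : Fin k) → pinch i (inject₁ i) ≡ i
pinch-inject₁-self zero    = refl
pinch-inject₁-self (suc i) = cong suc (pinch-inject₁-self i)

pinch-suc-self : (i : Fin k) → pinch i (suc i) ≡ i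
pinch-suc-self zero    = refl
pinch-suc-self (suc i) = cong suc (pinch-suc-self i)

pinch-punchIn-inject₁ : (i x : Fin k) → pinch i (punchIn (inject₁ i) x) ≡ x
pinch-punchIn-inject₁ zero    x       = refl
pinch-punchIn-inject₁ (suc i) zero    = refl
pinch-punchIn-inject₁ (suc i) (suc x) = cong suc (pinch-punchIn-inject₁ i x)

pinch-punchIn-suc : (i x : Fin k) → pinch i (punchIn (suc i) x) ≡ x
pinch-punchIn-suc zero    zero    = refl
pinch-punchIn-suc zero    (suc x) = refl
pinch-punchIn-suc (suc i) zero    = refl
pinch-punchIn-suc (suc i) (suc x) = cong suc (pinch-punchIn-suc i x)

pinch-inject₁-fromℕ : (i : Fin k) → pinch (inject₁ i) (fromℕ (suc k)) ≡ fromℕ k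
pinch-inject₁-fromℕ zero    = refl
pinch-inject₁-fromℕ (suc i) = cong suc (pinch-inject₁-fromℕ i)

pinch-punchIn-fromℕ : (i : Fin k) (x : Fin (suc k)) →
                      pinch (inject₁ i) (punchIn (fromℕ (suc k)) x) ≡ punchIn (fromℕ k) (pinch i x)
pinch-punchIn-fromℕ zero    zero    = refl
pinch-punchIn-fromℕ zero    (suc x) = refl
pinch-punchIn-fromℕ (suc i) zero    = refl
pinch-punchIn-fromℕ (suc i) (suc x) = cong suc (pinch-punchIn-fromℕ i x)

opposite-fromℕ : ∀ k → opposite (fromℕ k) ≡ zero
opposite-fromℕ zero    = refl
opposite-fromℕ (suc k) = cong inject₁ (opposite-fromℕ k)

opposite-inject₁ : (i : Fin k) → opposite (inject₁ i) ≡ suc (opposite i)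
opposite-inject₁ zero    = refl
opposite-inject₁ (suc i) = cong inject₁ (opposite-inject₁ i)

map-cancel : {B : Set} {f : B → A} {g : A → B} → (∀ x → f (g x) ≡ x) → (v : Vec A n) →
             map f (map g v) ≡ v
map-cancel {f = f} {g} f∘g≗id v = trans (sym (map-∘ f g v)) (trans (map-cong f∘g≗id v) (map-id v))

-- zigzag k g b = b 0, g 1, b 1, g 2, …, b (k-1), g k, the tail of a list
-- headed by g 0.
zigzag : ∀ k → (Fin (suc k) → A) → (Fin k → A) → List A
zigzag zero    g b = []
zigzag (suc k) g b = b zero ∷ g (suc zero) ∷ zigzag k (g ∘ suc) (b ∘ suc)

Image : (Fin (suc k) → A) → (Fin k → A) → A → Set
Image g b x = (∃ λ j → x ≡ g j) ⊎ (∃ λ j → x ≡ b j)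

∈-zigzag⁻ : ∀ k (g : Fin (suc k) → A) (b : Fin k → A) {x} →
            x ∈ g zero ∷ zigzag k g b → Image g b x
∈-zigzag⁻ k       g b (here x≡g0)              = inj₁ (zero , x≡g0)
∈-zigzag⁻ (suc k) g b (there (here x≡b0))      = inj₂ (zero , x≡b0)
∈-zigzag⁻ (suc k) g b (there (there x∈rest)) with ∈-zigzag⁻ k (g ∘ suc) (b ∘ suc) x∈rest
... | inj₁ (j , x≡gj) = inj₁ (suc j , x≡gj)
... | inj₂ (j , x≡bj) = inj₂ (suc j , x≡bj)

g∈zigzag : ∀ k (g : Fin (suc k) → A) (b : Fin k → A) j → g j ∈ g zero ∷ zigzag k g b
g∈zigzag k       g b zero    = here refl
g∈zigzag (suc k) g b (suc j) = there (there (g∈zigzag k (g ∘ suc) (b ∘ suc) j))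

b∈zigzag : ∀ k (g : Fin (suc k) → A) (b : Fin k → A) j → b j ∈ g zero ∷ zigzag k g b
b∈zigzag (suc k) g b zero    = there (here refl)
b∈zigzag (suc k) g b (suc j) = there (there (b∈zigzag k (g ∘ suc) (b ∘ suc) j))

last-zigzag : ∀ k (g : Fin (suc k) → A) (b : Fin k → A) →
              last (g zero) (zigzag k g b) ≡ g (fromℕ k)
last-zigzag zero    g b = refl
last-zigzag (suc k) g b = last-zigzag k (g ∘ suc) (b ∘ suc)

zigzag-linked : ∀ {R : A → A → Set} k (g : Fin (suc k) → A) (b : Fin k → A) →
                (∀ i → R (g (inject₁ i)) (b i)) → (∀ i → R (b i) (g (suc i))) →
                Linked R (g zero ∷ zigzag k g b)
zigzag-linked zero    g b gRb bRg = [-]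
zigzag-linked (suc k) g b gRb bRg =
  gRb zero ∷ bRg zero ∷ zigzag-linked k (g ∘ suc) (b ∘ suc) (gRb ∘ suc) (bRg ∘ suc)

zigzag-unique : ∀ k (g : Fin (suc k) → A) (b : Fin k → A) →
                (∀ {i j} → g i ≡ g j → i ≡ j) → (∀ {i j} → b i ≡ b j → i ≡ j) → (∀ {i j} → g i ≢ b j) →
                Unique (g zero ∷ zigzag k g b)
zigzag-unique zero    g b g-inj b-inj g≢b = [] ∷ []
zigzag-unique {A = A} (suc k) g b g-inj b-inj g≢b =
  (g≢b ∷ All.tabulate (g0∉ ∘ ∈-zigzag⁻ k g′ b′)) ∷
  (All.tabulate (b0∉ ∘ ∈-zigzag⁻ k g′ b′)) ∷
  zigzag-unique k g′ b′ (suc-injective ∘ g-inj) (suc-injective ∘ b-inj) g≢b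
  where
  g′ : Fin (suc k) → A
  g′ = g ∘ suc
  b′ : Fin k → A
  b′ = b ∘ suc
  g0∉ : ∀ {x} → Image g′ b′ x → g zero ≢ x
  g0∉ (inj₁ (j , refl)) g0≡gj with g-inj g0≡gj
  ... | ()
  g0∉ (inj₂ (j , refl)) = g≢b
  b0∉ : ∀ {x} → Image g′ b′ x → b zero ≢ x
  b0∉ (inj₁ (j , refl)) = g≢b ∘ sym
  b0∉ (inj₂ (j , refl)) b0≡bj with b-inj b0≡bj
  ... | ()

linked-++ : ∀ {R : A → A → Set} a as b bs →
            Linked R (a ∷ as) → R (last a as) b → Linked R (b ∷ bs) → Linked R (a ∷ (as ++ b ∷ bs))
linked-++ a []        b bs _            R-ab Rbs = R-ab ∷ Rbs
linked-++ a (a′ ∷ as) b bs (R-aa′ ∷ Ras) R-ab Rbs = R-aa′ ∷ linked-++ a′ as b bs Ras R-ab Rbs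

last-++ : (a : A) (as : List A) (b : A) (bs : List A) → last a (as ++ b ∷ bs) ≡ last b bs
last-++ a []        b bs = refl
last-++ a (a′ ∷ as) b bs = last-++ a′ as b bs

last-∈ : (a : A) (as : List A) → last a as ∈ a ∷ as
last-∈ a []        = here refl
last-∈ a (a′ ∷ as) = there (last-∈ a′ as)

last-map : ∀ {B : Set} (f : A → B) (a : A) (as : List A) → last (f a) (List.map f as) ≡ f (last a as)
last-map f a []        = refl
last-map f a (a′ ∷ as) = last-map f a′ as

blocks : OSP n → ℕ
blocks = proj₁

Adjacent : OSP n → OSP n → Set
Adjacent π π′ = Adj (just π) (just π′)

-- The new element is the first coordinate of the block-assignment vector.
addSingleton : (ρ : OSP n) → Fin (suc (blocks ρ)) → OSP (suc n)
addSingleton (k , v) j = suc k , j ∷ map (punchIn j) v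

addToBlock : (ρ : OSP n) → Fin (blocks ρ) → OSP (suc n)
addToBlock (k , v) j = k , j ∷ v

Extends : OSP (suc n) → OSP n → Set
Extends π ρ = Image (addSingleton ρ) (addToBlock ρ) π

addSingleton-IsOSP : (ρ : OSP n) → IsOSP ρ → ∀ j → IsOSP (addSingleton ρ j)
addSingleton-IsOSP (k , v) ρ-osp j i with j ≟ i
... | yes j≡i = VecAny.here (sym j≡i)
... | no  j≢i = VecAny.there (subst (_∈ᵥ map (punchIn j) v) (punchIn-punchOut j≢i)
                                    (VecMembership.∈-map⁺ (punchIn j) (ρ-osp (punchOut j≢i))))

addToBlock-IsOSP : (ρ : OSP n) → IsOSP ρ → ∀ j → IsOSP (addToBlock ρ j)
addToBlock-IsOSP (k , v) ρ-osp j i = VecAny.there (ρ-osp i)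

Extends-IsOSP : {π : OSP (suc n)} {ρ : OSP n} → Extends π ρ → IsOSP ρ → IsOSP π
Extends-IsOSP {ρ = ρ} (inj₁ (j , refl)) ρ-osp = addSingleton-IsOSP ρ ρ-osp j
Extends-IsOSP {ρ = ρ} (inj₂ (j , refl)) ρ-osp = addToBlock-IsOSP ρ ρ-osp j

private
  ≡-blocks⇒≡-vectors : {v w : Vec (Fin k) n} → _≡_ {A = OSP n} (k , v) (k , w) → v ≡ w
  ≡-blocks⇒≡-vectors = ,-injectiveʳ-UIP ℕ.≡-irrelevant

addSingleton-injective : (ρ : OSP n) {i j : Fin (suc (blocks ρ))} →
                         addSingleton ρ i ≡ addSingleton ρ j → i ≡ j
addSingleton-injective (k , v) = ∷-injectiveˡ ∘ ≡-blocks⇒≡-vectors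

addToBlock-injective : (ρ : OSP n) {i j : Fin (blocks ρ)} → addToBlock ρ i ≡ addToBlock ρ j → i ≡ j
addToBlock-injective (k , v) = ∷-injectiveˡ ∘ ≡-blocks⇒≡-vectors

addSingleton≢addToBlock : (ρ : OSP n) {i : Fin (suc (blocks ρ))} {j : Fin (blocks ρ)} →
                          addSingleton ρ i ≢ addToBlock ρ j
addSingleton≢addToBlock (k , v) = ℕ.1+n≢n ∘ ,-injectiveˡ

removeBlock : (b : Fin (suc k)) (v : Vec (Fin (suc k)) n) → b ∉ᵥ v → Vec (Fin k) n
removeBlock b []      b∉v = []
removeBlock b (x ∷ v) b∉v = punchOut (b∉v ∘ VecAny.here) ∷ removeBlock b v (b∉v ∘ VecAny.there)

-- The block b of the new element is a singleton iff b does not occur in v.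
restrict : OSP (suc n) → OSP n
restrict (zero  , () ∷ _)
restrict (suc k , b ∷ v) with VecAny.any? (b ≟_) v
... | yes _   = suc k , v
... | no  b∉v = k , removeBlock b v b∉v

∉-map-punchIn : (b : Fin (suc k)) (v : Vec (Fin k) n) → b ∉ᵥ map (punchIn b) v
∉-map-punchIn b (x ∷ v) (VecAny.here b≡x)   = punchInᵢ≢i b x (sym b≡x)
∉-map-punchIn b (x ∷ v) (VecAny.there b∈v) = ∉-map-punchIn b v b∈v

removeBlock-punchIn : (b : Fin (suc k)) (v : Vec (Fin k) n) (b∉v : b ∉ᵥ map (punchIn b) v) →
                      removeBlock b (map (punchIn b) v) b∉v ≡ v
removeBlock-punchIn b []      b∉v = refl
removeBlock-punchIn b (x ∷ v) b∉v =
  cong₂ _∷_ (trans (punchOut-cong b refl) (punchOut-punchIn b)) (removeBlock-punchIn b v _)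

punchIn-removeBlock : (b : Fin (suc k)) (v : Vec (Fin (suc k)) n) (b∉v : b ∉ᵥ v) →
                      map (punchIn b) (removeBlock b v b∉v) ≡ v
punchIn-removeBlock b []      b∉v = refl
punchIn-removeBlock b (x ∷ v) b∉v = cong₂ _∷_ (punchIn-punchOut _) (punchIn-removeBlock b v _)

∈-removeBlock : (b : Fin (suc k)) (v : Vec (Fin (suc k)) n) (b∉v : b ∉ᵥ v) {x : Fin (suc k)}
                (b≢x : b ≢ x) → x ∈ᵥ v → punchOut b≢x ∈ᵥ removeBlock b v b∉v
∈-removeBlock b (y ∷ v) b∉v b≢x (VecAny.here refl)  = VecAny.here (punchOut-cong b refl)
∈-removeBlock b (y ∷ v) b∉v b≢x (VecAny.there x∈v) = VecAny.there (∈-removeBlock b v _ b≢x x∈v)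

restrict-addSingleton : (ρ : OSP n) (j : Fin (suc (blocks ρ))) → restrict (addSingleton ρ j) ≡ ρ
restrict-addSingleton (k , v) j with VecAny.any? (j ≟_) (map (punchIn j) v)
... | yes j∈v = ⊥-elim (∉-map-punchIn j v j∈v)
... | no  j∉v = cong (k ,_) (removeBlock-punchIn j v j∉v)

restrict-addToBlock : (ρ : OSP n) → IsOSP ρ → (j : Fin (blocks ρ)) → restrict (addToBlock ρ j) ≡ ρ
restrict-addToBlock (suc k , v) ρ-osp j with VecAny.any? (j ≟_) v
... | yes _   = refl
... | no  j∉v = ⊥-elim (j∉v (ρ-osp j))

restrict-Extends : {π : OSP (suc n)} {ρ : OSP n} → Extends π ρ → IsOSP ρ → restrict π ≡ ρ
restrict-Extends {ρ = ρ} (inj₁ (j , refl)) ρ-osp = restrict-addSingleton ρ j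
restrict-Extends {ρ = ρ} (inj₂ (j , refl)) ρ-osp = restrict-addToBlock ρ ρ-osp j

Extends-restrict : (π : OSP (suc n)) → IsOSP π → Extends π (restrict π) × IsOSP (restrict π)
Extends-restrict (zero  , () ∷ v) π-osp
Extends-restrict (suc k , b ∷ v) π-osp with VecAny.any? (b ≟_) v
... | yes b∈v = inj₂ (b , refl) , ρ-osp
  where
  ρ-osp : IsOSP (suc k , v)
  ρ-osp i with π-osp i
  ... | VecAny.here refl  = b∈v
  ... | VecAny.there i∈v = i∈v
... | no b∉v = inj₁ (b , cong (λ u → suc k , b ∷ u) (sym (punchIn-removeBlock b v b∉v))) , ρ-osp
  where
  ρ-osp : IsOSP (k , removeBlock b v b∉v)
  ρ-osp i with π-osp (punchIn b i)
  ... | VecAny.here b̂≡b   = ⊥-elim (punchInᵢ≢i b i b̂≡b)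
  ... | VecAny.there b̂∈v =
    subst (_∈ᵥ removeBlock b v b∉v) (trans (punchOut-cong b refl) (punchOut-punchIn b))
          (∈-removeBlock b v b∉v (punchInᵢ≢i b i ∘ sym) b̂∈v)

merge⋖-≡ : (w : Vec (Fin (suc k)) n) (i : Fin k) → IsOSP (suc k , w) → {u : Vec (Fin k) n} →
           map (pinch i) w ≡ u → _⋖_ {n} (just (suc k , w)) (just (k , u))
merge⋖-≡ w i w-osp refl = merge⋖ w i w-osp

-- Merging the singleton {0} in gap i with the block following it, resp.
-- preceding it in gap i + 1, puts 0 into block i.
addSingleton⋖addToBlock : (ρ : OSP n) → IsOSP ρ → (i : Fin (blocks ρ)) →
                          just (addSingleton ρ (inject₁ i)) ⋖ just (addToBlock ρ i)
addSingleton⋖addToBlock (suc k , v) ρ-osp i =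
  merge⋖-≡ _ i (addSingleton-IsOSP _ ρ-osp _)
    (cong₂ _∷_ (pinch-inject₁-self i) (map-cancel (pinch-punchIn-inject₁ i) v))

addSingleton-suc⋖addToBlock : (ρ : OSP n) → IsOSP ρ → (i : Fin (blocks ρ)) →
                              just (addSingleton ρ (suc i)) ⋖ just (addToBlock ρ i)
addSingleton-suc⋖addToBlock (suc k , v) ρ-osp i =
  merge⋖-≡ _ i (addSingleton-IsOSP _ ρ-osp _)
    (cong₂ _∷_ (pinch-suc-self i) (map-cancel (pinch-punchIn-suc i) v))

endGap : Bool → Fin (suc k)
endGap true  = fromℕ _
endGap false = zero

addSingleton-endGap-⋖ : ∀ d {π π′ : OSP n} → just π ⋖ just π′ →
                        just (addSingleton π (endGap d)) ⋖ just (addSingleton π′ (endGap d))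
addSingleton-endGap-⋖ true (merge⋖ {k} v i π-osp) =
  merge⋖-≡ _ (inject₁ i) (addSingleton-IsOSP _ π-osp _)
    (cong₂ _∷_ (pinch-inject₁-fromℕ i)
               (begin
                 map (pinch (inject₁ i)) (map (punchIn (fromℕ (suc k))) v) ≡⟨ map-∘ _ _ v ⟨
                 map (pinch (inject₁ i) ∘ punchIn (fromℕ (suc k))) v       ≡⟨ map-cong (pinch-punchIn-fromℕ i) v ⟩
                 map (punchIn (fromℕ k) ∘ pinch i) v                        ≡⟨ map-∘ _ _ v ⟩
                 map (punchIn (fromℕ k)) (map (pinch i) v)                  ∎))
addSingleton-endGap-⋖ false (merge⋖ v i π-osp) =
  merge⋖-≡ _ (suc i) (addSingleton-IsOSP _ π-osp _)
    (cong (zero ∷_) (trans (sym (map-∘ (pinch (suc i)) suc v)) (map-∘ suc (pinch i) v)))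

addSingleton-endGap-Adjacent : ∀ d {π π′ : OSP n} → Adjacent π π′ →
                               Adjacent (addSingleton π (endGap d)) (addSingleton π′ (endGap d))
addSingleton-endGap-Adjacent d = map-⊎ (addSingleton-endGap-⋖ d) (addSingleton-endGap-⋖ d)

orient : Bool → Fin k → Fin k
orient true  j = j
orient false j = opposite j

orient-involutive : ∀ d (j : Fin k) → orient d (orient d j) ≡ j
orient-involutive true  j = refl
orient-involutive false j = opposite-involutive j

orient-injective : ∀ d {i j : Fin k} → orient d i ≡ orient d j → i ≡ j
orient-injective d {i} {j} eq = begin
  i                     ≡⟨ orient-involutive d i ⟨
  orient d (orient d i) ≡⟨ cong (orient d) eq ⟩
  orient d (orient d j) ≡⟨ orient-involutive d j ⟩
  j                     ∎

orient-fromℕ : ∀ d → orient d (fromℕ k) ≡ endGap d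
orient-fromℕ true  = refl
orient-fromℕ false = opposite-fromℕ _

orient-not-zero : ∀ d → orient (not d) zero ≡ endGap {k} d
orient-not-zero true  = refl
orient-not-zero false = refl

laterExtensions : Bool → (ρ : OSP n) → List (OSP (suc n))
laterExtensions d ρ = zigzag (blocks ρ) (addSingleton ρ ∘ orient d) (addToBlock ρ ∘ orient d)

extensions : Bool → OSP n → List (OSP (suc n))
extensions d ρ = addSingleton ρ (orient d zero) ∷ laterExtensions d ρ

∈-extensions⁻ : ∀ d (ρ : OSP n) {π} → π ∈ extensions d ρ → Extends π ρ
∈-extensions⁻ d ρ π∈ with ∈-zigzag⁻ _ (addSingleton ρ ∘ orient d) (addToBlock ρ ∘ orient d) π∈
... | inj₁ (j , π≡) = inj₁ (orient d j , π≡)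
... | inj₂ (j , π≡) = inj₂ (orient d j , π≡)

∈-extensions⁺ : ∀ d (ρ : OSP n) {π} → Extends π ρ → π ∈ extensions d ρ
∈-extensions⁺ d ρ (inj₁ (j , refl)) =
  subst (λ i → addSingleton ρ i ∈ extensions d ρ) (orient-involutive d j)
    (g∈zigzag _ (addSingleton ρ ∘ orient d) (addToBlock ρ ∘ orient d) (orient d j))
∈-extensions⁺ d ρ (inj₂ (j , refl)) =
  subst (λ i → addToBlock ρ i ∈ extensions d ρ) (orient-involutive d j)
    (b∈zigzag _ (addSingleton ρ ∘ orient d) (addToBlock ρ ∘ orient d) (orient d j))

extensions-unique : ∀ d (ρ : OSP n) → Unique (extensions d ρ)
extensions-unique d ρ =
  zigzag-unique _ (addSingleton ρ ∘ orient d) (addToBlock ρ ∘ orient d)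
    (orient-injective d ∘ addSingleton-injective ρ) (orient-injective d ∘ addToBlock-injective ρ)
    (addSingleton≢addToBlock ρ)

extensions-linked : ∀ d (ρ : OSP n) → IsOSP ρ → Linked Adjacent (extensions d ρ)
extensions-linked true ρ ρ-osp =
  zigzag-linked _ (addSingleton ρ) (addToBlock ρ)
    (inj₁ ∘ addSingleton⋖addToBlock ρ ρ-osp) (inj₂ ∘ addSingleton-suc⋖addToBlock ρ ρ-osp)
extensions-linked false ρ ρ-osp =
  zigzag-linked _ (addSingleton ρ ∘ opposite) (addToBlock ρ ∘ opposite)
    (λ i → inj₁ (subst (λ j → just (addSingleton ρ j) ⋖ just (addToBlock ρ (opposite i)))
                       (sym (opposite-inject₁ i)) (addSingleton-suc⋖addToBlock ρ ρ-osp (opposite i))))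
    (λ i → inj₂ (addSingleton⋖addToBlock ρ ρ-osp (opposite i)))

last-extensions : ∀ d (ρ : OSP n) →
                  last (addSingleton ρ (orient d zero)) (laterExtensions d ρ) ≡ addSingleton ρ (endGap d)
last-extensions d ρ =
  trans (last-zigzag _ (addSingleton ρ ∘ orient d) (addToBlock ρ ∘ orient d))
        (cong (addSingleton ρ) (orient-fromℕ d))

snake : Bool → List (OSP n) → List (OSP (suc n))
snake d []       = []
snake d (ρ ∷ ρs) = extensions d ρ ++ snake (not d) ρs

∈-snake⁺ : ∀ d (ρs : List (OSP n)) {π ρ} → ρ ∈ ρs → Extends π ρ → π ∈ snake d ρs
∈-snake⁺ d (ρ ∷ ρs) (here refl) π⊐ρ = ∈-++⁺ˡ (∈-extensions⁺ d ρ π⊐ρ)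
∈-snake⁺ d (ρ ∷ ρs) (there ρ∈) π⊐ρ = ∈-++⁺ʳ (extensions d ρ) (∈-snake⁺ (not d) ρs ρ∈ π⊐ρ)

∈-snake⁻ : ∀ d (ρs : List (OSP n)) {π} → π ∈ snake d ρs → ∃ λ ρ → ρ ∈ ρs × Extends π ρ
∈-snake⁻ d (ρ ∷ ρs) π∈ with ∈-++⁻ (extensions d ρ) π∈
... | inj₁ π∈ext = ρ , here refl , ∈-extensions⁻ d ρ π∈ext
... | inj₂ π∈rest with ∈-snake⁻ (not d) ρs π∈rest
...   | ρ′ , ρ′∈ , π⊐ρ′ = ρ′ , there ρ′∈ , π⊐ρ′

snake-IsOSP : ∀ d (ρs : List (OSP n)) → All IsOSP ρs → All IsOSP (snake d ρs)
snake-IsOSP d ρs ρs-osp = All.tabulate λ π∈ →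
  let ρ , ρ∈ , π⊐ρ = ∈-snake⁻ d ρs π∈ in Extends-IsOSP π⊐ρ (All.lookup ρs-osp ρ∈)

-- Fibres of distinct faces are disjoint since restrict recovers the face.
snake-unique : ∀ d (ρs : List (OSP n)) → Unique ρs → All IsOSP ρs → Unique (snake d ρs)
snake-unique d []       []            []             = []
snake-unique d (ρ ∷ ρs) (ρ∉ρs ∷ ρs-u) (ρ-osp ∷ ρs-osp) =
  Unique.++⁺ (extensions-unique d ρ) (snake-unique (not d) ρs ρs-u ρs-osp) disjoint
  where
  disjoint : ∀ {π} → ¬ (π ∈ extensions d ρ × π ∈ snake (not d) ρs)
  disjoint (π∈ext , π∈rest) with ∈-snake⁻ (not d) ρs π∈rest
  ... | ρ′ , ρ′∈ , π⊐ρ′ = All.lookup ρ∉ρs ρ′∈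
    (trans (sym (restrict-Extends (∈-extensions⁻ d ρ π∈ext) ρ-osp))
           (restrict-Extends π⊐ρ′ (All.lookup ρs-osp ρ′∈)))

snake-linked : ∀ d (ρ : OSP n) ρs → Linked Adjacent (ρ ∷ ρs) → All IsOSP (ρ ∷ ρs) →
               Linked Adjacent (snake d (ρ ∷ ρs))
snake-linked d ρ []        [-]            (ρ-osp ∷ []) =
  subst (Linked Adjacent) (sym (++-identityʳ _)) (extensions-linked d ρ ρ-osp)
snake-linked d ρ (ρ′ ∷ ρs) (ρ~ρ′ ∷ linked) (ρ-osp ∷ osps) =
  linked-++ _ (laterExtensions d ρ) _ _ (extensions-linked d ρ ρ-osp) junction
    (snake-linked (not d) ρ′ ρs linked osps)
  where
  junction : Adjacent (last (addSingleton ρ (orient d zero)) (laterExtensions d ρ))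
                      (addSingleton ρ′ (orient (not d) zero))
  junction = subst₂ Adjacent (sym (last-extensions d ρ)) (cong (addSingleton ρ′) (sym (orient-not-zero d)))
                      (addSingleton-endGap-Adjacent d ρ~ρ′)

blocks-last-snake : ∀ d (ρ : OSP n) ρs →
                    blocks (last (addSingleton ρ (orient d zero)) (laterExtensions d ρ ++ snake (not d) ρs))
                      ≡ suc (blocks (last ρ ρs))
blocks-last-snake d ρ [] = cong blocks (begin
  last (addSingleton ρ (orient d zero)) (laterExtensions d ρ ++ [])
    ≡⟨ cong (last _) (++-identityʳ (laterExtensions d ρ)) ⟩
  last (addSingleton ρ (orient d zero)) (laterExtensions d ρ)
    ≡⟨ last-extensions d ρ ⟩
  addSingleton ρ (endGap d)
    ∎)
blocks-last-snake d ρ (ρ′ ∷ ρs) =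
  trans (cong blocks (last-++ _ (laterExtensions d ρ) _ _)) (blocks-last-snake (not d) ρ′ ρs)

record HamiltonianPath (n : ℕ) : Set where
  field
    start    : OSP n
    rest     : List (OSP n)
    faces    : All IsOSP (start ∷ rest)
    unique   : Unique (start ∷ rest)
    complete : ∀ π → IsOSP π → π ∈ start ∷ rest
    linked   : Linked Adjacent (start ∷ rest)
    start-vertex : blocks start ≡ n
    end-vertex   : blocks (last start rest) ≡ n

open HamiltonianPath

path-suc : HamiltonianPath n → HamiltonianPath (suc n)
path-suc P = record
  { start    = addSingleton (start P) zero
  ; rest     = laterExtensions true (start P) ++ snake false (rest P)
  ; faces    = snake-IsOSP true (start P ∷ rest P) (faces P)
  ; unique   = snake-unique true (start P ∷ rest P) (unique P) (faces P)
  ; complete = λ π π-osp →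
      let π⊐ρ , ρ-osp = Extends-restrict π π-osp in
      ∈-snake⁺ true (start P ∷ rest P) (complete P (restrict π) ρ-osp) π⊐ρ
  ; linked   = snake-linked true (start P) (rest P) (linked P) (faces P)
  ; start-vertex = cong suc (start-vertex P)
  ; end-vertex   = trans (blocks-last-snake true (start P) (rest P)) (cong suc (end-vertex P))
  }

path-one : HamiltonianPath 1
path-one = record
  { start    = 1 , zero ∷ []
  ; rest     = []
  ; faces    = (λ { zero → VecAny.here refl }) ∷ []
  ; unique   = [] ∷ []
  ; complete = complete-one
  ; linked   = [-]
  ; start-vertex = refl
  ; end-vertex   = refl
  }
  where
  complete-one : ∀ π → IsOSP π → π ∈ (1 , zero ∷ []) ∷ []
  complete-one (zero , () ∷ [])
  complete-one (suc zero , zero ∷ []) _ = here refl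
  complete-one (suc (suc k) , j ∷ []) π-osp with π-osp zero | π-osp (suc zero)
  ... | VecAny.here refl | VecAny.here ()
  ... | _                | VecAny.there ()
  ... | VecAny.there ()  | _

-- For n ≥ 1 the start already has a block, so its fibre has a second element.
rest-path-suc-nonempty : (P : HamiltonianPath (suc n)) → 1 ≤ length (rest (path-suc P))
rest-path-suc-nonempty {n} P = nonempty (start P) (start-vertex P) (snake false (rest P))
  where
  nonempty : (ρ : OSP (suc n)) → blocks ρ ≡ suc n → ∀ πs → 1 ≤ length (laterExtensions true ρ ++ πs)
  nonempty (suc k , v) refl πs = s≤s z≤n

path : ∀ n → HamiltonianPath (suc n)
path zero    = path-one
path (suc n) = path-suc (path n)

vertex-⋖ : (π : OSP n) → blocks π ≡ n → IsOSP π → _⋖_ {n} nothing (just π)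
vertex-⋖ (k , v) refl π-osp = empty⋖vertex v π-osp

path⇒cycle : (P : HamiltonianPath n) → 1 ≤ length (rest P) → HasHamiltonianCycle n
path⇒cycle P 1≤length = nothing , List.map just (start P ∷ rest P) ,
  (tt ∷ All.map⁺ (faces P)) ,
  (All.map⁺ (All.universal (λ _ ()) _) ∷ Unique.map⁺ just-injective (unique P)) ,
  complete′ ,
  (inj₁ (vertex-⋖ (start P) (start-vertex P) start-IsOSP) ∷ Linked.map⁺ (linked P)) ,
  subst (λ F → Adj F nothing) (sym (last-map just (start P) (rest P)))
    (inj₂ (vertex-⋖ (last (start P) (rest P)) (end-vertex P) end-IsOSP)) ,
  subst (2 ≤_) (sym (length-map just (start P ∷ rest P))) (s≤s 1≤length)
  where
  start-IsOSP : IsOSP (start P)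
  start-IsOSP = All.lookup (faces P) (here refl)
  end-IsOSP : IsOSP (last (start P) (rest P))
  end-IsOSP = All.lookup (faces P) (last-∈ (start P) (rest P))
  complete′ : ∀ F → IsFace F → F ∈ nothing ∷ List.map just (start P ∷ rest P)
  complete′ nothing  _     = here refl
  complete′ (just π) π-osp = there (∈-map⁺ just (complete P π π-osp))

theorem7 : ∀ (n : ℕ) → 2 ≤ n → HasHamiltonianCycle n
theorem7 (suc (suc n)) (s≤s (s≤s z≤n)) = path⇒cycle (path (suc n)) (rest-path-suc-nonempty (path n))
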